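{- Let $p(x)$ be a primitive polynomial of degree $n$ over $\mathbf Z/2\mathbf Z$, let $\mathbf E$ be its splitting field, represented as polynomials in $\alpha$ modulo $p(\alpha)$ (so $\alpha$ has multiplicative order $2^n-1$), and let $k\ge1$. For an integer $c$, there is a tuple $\langle t_0,\dots,t_{k-1}\rangle\in[n]^k$ such that $\prod_{i\in[k]}\alpha^{2^{t_i}}=\alpha^c$ if and only if there is a set $S\subseteq[n]$ with $0<|S|\le k$ and $c\equiv\sum_{s\in S}2^s \pmod{2^n-1}$.
   Context: $[n]=\{0,1,\dots,n-1\}$. Exponents of $\alpha$ are computed modulo $2^n-1$. -}

module Defs where

open import Data.Bool using (Bool; true; false; _xor_; _∧_; if_then_else_)
open import Data.Nat using (ℕ; zero; suc; _^_; _∸_; _≤_; _<_)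
open import Data.Vec using (Vec; []; _∷_; replicate; zipWith; map; init; last; tabulate; lookup; sum; foldr)
open import Data.Fin using (Fin; toℕ)
open import Data.Fin.Subset using (Subset)
open import Data.Integer using (ℤ)
open import Data.Integer.DivMod using (_%ℕ_)
open import Data.Product using (_×_)
open import Data.Sum using (_⊎_)
open import Relation.Binary.PropositionalEquality using (_≡_; _≢_)

-- A monic polynomial  p(x) = x^n + p_{n-1} x^{n-1} + ... + p_0  over Z/2Z of
-- degree n is represented by the vector of its low coefficients
-- (p_0, ..., p_{n-1}) : Vec Bool n   (true = 1, false = 0).
-- An element of F2[x]/(p(x)) is represented canonically by the coefficient
-- vector (a_0, ..., a_{n-1}) of its reduced representative  Σ a_i α^i.

Elem : ℕ → Set
Elem n = Vec Bool n

zeroE : ∀ {n} → Elem n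
zeroE = replicate _ false

oneE : ∀ {n} → Elem n
oneE {zero}  = []
oneE {suc n} = true ∷ replicate n false

addE : ∀ {n} → Elem n → Elem n → Elem n
addE = zipWith _xor_

scaleE : ∀ {n} → Bool → Elem n → Elem n
scaleE b = map (b ∧_)

-- multiplication by α (= x) modulo p, using α^n = p_0 + p_1 α + ... + p_{n-1} α^{n-1}
mulα : ∀ {n} → Vec Bool n → Elem n → Elem n
mulα {zero}  p a = []
mulα {suc n} p a = addE (false ∷ init a) (scaleE (last a) p)

mulAux : ∀ {m n} → Vec Bool n → Vec Bool m → Elem n → Elem n
mulAux p []       b = zeroE
mulAux p (a ∷ as) b = addE (scaleE a b) (mulAux p as (mulα p b))

mulE : ∀ {n} → Vec Bool n → Elem n → Elem n → Elem n
mulE p a b = mulAux p a b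

α : ∀ {n} → Vec Bool n → Elem n
α p = mulα p oneE

powE : ∀ {n} → Vec Bool n → Elem n → ℕ → Elem n
powE p a zero    = oneE
powE p a (suc m) = mulE p a (powE p a m)

prodE : ∀ {n k} → Vec Bool n → Vec (Elem n) k → Elem n
prodE p = foldr _ (mulE p) oneE

-- reduction of an integer modulo N (N = 0 gives 0; only used with N ≥ 1)
modN : ℕ → ℤ → ℕ
modN zero    c = 0
modN (suc m) c = c %ℕ suc m

powℤE : ∀ {n} → Vec Bool n → Elem n → ℤ → Elem n
powℤE {n} p a c = powE p a (modN (2 ^ n ∸ 1) c)

-- p irreducible: F2[x]/(p) has no zero divisors (i.e. (p) is a prime ideal)
Irreducible : ∀ {n} → Vec Bool n → Set
Irreducible p = ∀ a b → mulE p a b ≡ zeroE → (a ≡ zeroE) ⊎ (b ≡ zeroE)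

Primitive : ∀ {n} → Vec Bool n → Set
Primitive {n} p =
  (1 ≤ n) × Irreducible p
  × (powE p (α p) (2 ^ n ∸ 1) ≡ oneE)
  × (∀ m → 0 < m → m < 2 ^ n ∸ 1 → powE p (α p) m ≢ oneE)

subsetSum : ∀ {n} → Subset n → ℕ
subsetSum {n} S = sum (tabulate {n = n} (λ i → if lookup S i then 2 ^ toℕ i else 0))

-- Writing N = 2^n − 1, α has order N, so ∏ α^(2^tᵢ) = α^(Σ 2^tᵢ) and α^a = α^b iff a ≡ b (mod N);
-- the claim thus says that the residues mod N of sums of k powers 2^t (t < n) are exactly those
-- of Σ_{s∈S} 2^s with 0 < |S| ≤ k. A tuple becomes such a set by adding its powers one at a
-- time in binary with end-around carry (2^n ≡ 1), each addition raising the number of ones by at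
-- most one. Conversely a set becomes a tuple of any length k ≥ |S| by repeatedly splitting a
-- term: 2^(t+1) = 2^t + 2^t and 2^0 ≡ 2^(n−1) + 2^(n−1).
module Submission where

open import Defs
open import Algebra.Bundles using (CommutativeRing)
open import Data.Bool using (Bool; true; false; _xor_; _∧_; if_then_else_)
open import Data.Bool.Properties
  using (xor-assoc; xor-same; xor-identityˡ; xor-identityʳ; ∧-comm; ∧-zeroʳ; ∧-identityʳ; ∧-distribʳ-xor;
         xor-∧-commutativeRing; if-float)
open import Data.Empty using (⊥-elim)
open import Data.Fin using (Fin; toℕ; fromℕ; inject₁) renaming (zero to fzero; suc to fsuc)
open import Data.Fin.Properties using (toℕ<n; toℕ-fromℕ; toℕ-inject₁)
open import Data.Fin.Subset using (Subset; ∣_∣) renaming (⊥ to ∅)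
open import Data.Fin.Subset.Properties using (∣⊥∣≡0)
open import Data.Integer as ℤ using (ℤ; +_; _-_; _%ℕ_; _/ℕ_)
open import Data.Integer.DivMod using (a≡a%ℕn+[a/ℕn]*n; n%ℕd<d)
open import Data.Integer.Divisibility using (_∣_)
open import Data.Integer.Divisibility.Signed as Signed using (∣ᵤ⇒∣; ∣⇒∣ᵤ; ∣m+n∣n⇒∣m; ∣n⇒∣m*n; ∣-refl)
import Data.Integer.Properties as ℤ
open import Data.Integer.Tactic.RingSolver as ℤ-Solver using ()
open import Data.Nat
  using (ℕ; zero; suc; pred; _+_; _*_; _^_; _∸_; _%_; _/_; _≤_; _<_; _≤′_; ≤′-refl; ≤′-step; _≡ᵇ_; z≤n; s≤s;
         NonZero; >-nonZero)
open import Data.Nat.Properties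
open import Data.Nat.DivMod using (m≡m%n+[m/n]*n; m%n<n; m<n⇒m%n≡m; %-distribˡ-+; [m+n]%n≡m%n)
open import Data.Nat.Divisibility using (n∣m⇒m%n≡0) renaming (_∣_ to _∣ℕ_)
open import Data.Nat.Tactic.RingSolver using (solve-∀)
open import Data.Product using (∃; _×_; _,_; proj₁; proj₂; map₁)
open import Data.Product.Function.Dependent.Propositional using (congˡ)
open import Data.Product.Function.NonDependent.Propositional using (_×-⇔_)
open import Data.Sum using (inj₁; inj₂)
open import Data.Vec using (Vec; []; _∷_; replicate; map; init; last; _++_; sum; tabulate; lookup)
open import Data.Vec.Properties
  using (zipWith-assoc; zipWith-identityˡ; zipWith-identityʳ; map-id; map-const; tabulate-cong)
open import Function using (_∘_)
open import Function.Bundles using (_⇔_; mk⇔)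
open import Function.Construct.Composition using (_⇔-∘_)
open import Function.Construct.Identity using (⇔-id)
open import Function.Construct.Symmetry using (⇔-sym)
open import Function.Properties.Equivalence using (⇔-setoid)
open import Level using (0ℓ)
open import Relation.Binary.PropositionalEquality
open import Algebra.Properties.CommutativeSemigroup
  (CommutativeRing.+-commutativeSemigroup xor-∧-commutativeRing) using () renaming (interchange to xor-interchange)

private variable
  k m n : ℕ

-- Addition in F₂[x]/(p)

addE-assoc : (a b c : Elem n) → addE (addE a b) c ≡ addE a (addE b c)
addE-assoc = zipWith-assoc xor-assoc

addE-identityˡ : (a : Elem n) → addE zeroE a ≡ a
addE-identityˡ = zipWith-identityˡ xor-identityˡ

addE-identityʳ : (a : Elem n) → addE a zeroE ≡ a
addE-identityʳ = zipWith-identityʳ xor-identityʳ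

addE-self : (a : Elem n) → addE a a ≡ zeroE
addE-self []      = refl
addE-self (x ∷ a) = cong₂ _∷_ (xor-same x) (addE-self a)

addE-interchange : (a b c d : Elem n) → addE (addE a b) (addE c d) ≡ addE (addE a c) (addE b d)
addE-interchange []      []      []      []      = refl
addE-interchange (x ∷ a) (y ∷ b) (z ∷ c) (w ∷ d) =
  cong₂ _∷_ (xor-interchange x y z w) (addE-interchange a b c d)

addE≡zero⇒≡ : (a b : Elem n) → addE a b ≡ zeroE → a ≡ b
addE≡zero⇒≡ a b a+b≡0 = begin
  a                   ≡⟨ addE-identityʳ a ⟨
  addE a zeroE        ≡⟨ cong (addE a) (addE-self b) ⟨
  addE a (addE b b)   ≡⟨ addE-assoc a b b ⟨
  addE (addE a b) b   ≡⟨ cong (λ x → addE x b) a+b≡0 ⟩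
  addE zeroE b        ≡⟨ addE-identityˡ b ⟩
  b                   ∎
  where open ≡-Reasoning

scaleE-true : (a : Elem n) → scaleE true a ≡ a
scaleE-true = map-id

scaleE-false : (a : Elem n) → scaleE false a ≡ zeroE
scaleE-false a = map-const a false

scaleE-distrib-xor : ∀ x y (a : Elem n) → scaleE (x xor y) a ≡ addE (scaleE x a) (scaleE y a)
scaleE-distrib-xor x y []      = refl
scaleE-distrib-xor x y (z ∷ a) = cong₂ _∷_ (∧-distribʳ-xor z x y) (scaleE-distrib-xor x y a)

-- Multiplication by α

init-addE : (a b : Elem (suc n)) → init (addE a b) ≡ addE (init a) (init b)
init-addE {zero}  (x ∷ []) (y ∷ []) = refl
init-addE {suc n} (x ∷ a)  (y ∷ b)  = cong ((x xor y) ∷_) (init-addE a b)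

last-addE : (a b : Elem (suc n)) → last (addE a b) ≡ last a xor last b
last-addE {zero}  (x ∷ []) (y ∷ []) = refl
last-addE {suc n} (x ∷ a)  (y ∷ b)  = last-addE a b

mulα-addE : (p a b : Elem n) → mulα p (addE a b) ≡ addE (mulα p a) (mulα p b)
mulα-addE {zero}  p a b = refl
mulα-addE {suc n} p a b = begin
  addE (false ∷ init (addE a b)) (scaleE (last (addE a b)) p)
    ≡⟨ cong₂ (λ u c → addE (false ∷ u) (scaleE c p)) (init-addE a b) (last-addE a b) ⟩
  addE (addE (false ∷ init a) (false ∷ init b)) (scaleE (last a xor last b) p)
    ≡⟨ cong (addE _) (scaleE-distrib-xor (last a) (last b) p) ⟩
  addE (addE (false ∷ init a) (false ∷ init b)) (addE (scaleE (last a) p) (scaleE (last b) p))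
    ≡⟨ addE-interchange _ _ _ _ ⟩
  addE (mulα p a) (mulα p b) ∎
  where open ≡-Reasoning

mulα-zero : (p : Elem n) → mulα p zeroE ≡ zeroE
mulα-zero p = begin
  mulα p zeroE                           ≡⟨ cong (mulα p) (addE-self zeroE) ⟨
  mulα p (addE zeroE zeroE)              ≡⟨ mulα-addE p zeroE zeroE ⟩
  addE (mulα p zeroE) (mulα p zeroE)     ≡⟨ addE-self _ ⟩
  zeroE                                  ∎
  where open ≡-Reasoning

mulα-scaleE : (p : Elem n) (c : Bool) (a : Elem n) → mulα p (scaleE c a) ≡ scaleE c (mulα p a)
mulα-scaleE p true  a = trans (cong (mulα p) (scaleE-true a)) (sym (scaleE-true _))
mulα-scaleE p false a = trans (cong (mulα p) (scaleE-false a)) (trans (mulα-zero p) (sym (scaleE-false _)))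

mulAux-mulα : (p : Elem n) (as : Vec Bool m) (b : Elem n) → mulAux p as (mulα p b) ≡ mulα p (mulAux p as b)
mulAux-mulα p []       b = sym (mulα-zero p)
mulAux-mulα p (a ∷ as) b = begin
  addE (scaleE a (mulα p b)) (mulAux p as (mulα p (mulα p b)))
    ≡⟨ cong₂ addE (sym (mulα-scaleE p a b)) (mulAux-mulα p as (mulα p b)) ⟩
  addE (mulα p (scaleE a b)) (mulα p (mulAux p as (mulα p b)))
    ≡⟨ mulα-addE p _ _ ⟨
  mulα p (mulAux p (a ∷ as) b) ∎
  where open ≡-Reasoning

mulAux-zeroˡ : ∀ m (p b : Elem n) → mulAux p (replicate m false) b ≡ zeroE
mulAux-zeroˡ zero    p b = refl
mulAux-zeroˡ (suc m) p b = begin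
  addE (scaleE false b) (mulAux p (replicate m false) (mulα p b))
    ≡⟨ cong₂ addE (scaleE-false b) (mulAux-zeroˡ m p (mulα p b)) ⟩
  addE zeroE zeroE ≡⟨ addE-self zeroE ⟩
  zeroE ∎
  where open ≡-Reasoning

init-replicate : ∀ {A : Set} k (x : A) → init (replicate (suc k) x) ≡ replicate k x
init-replicate zero    x = refl
init-replicate (suc k) x = cong (x ∷_) (init-replicate k x)

last-replicate : ∀ {A : Set} k (x : A) → last (replicate (suc k) x) ≡ x
last-replicate zero    x = refl
last-replicate (suc k) x = last-replicate k x

α≡e₁ : (p : Elem (suc (suc n))) → α p ≡ false ∷ true ∷ replicate n false
α≡e₁ {n} p = begin
  addE (false ∷ true ∷ init (replicate (suc n) false)) (scaleE (last (replicate (suc n) false)) p)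
    ≡⟨ cong₂ (λ u c → addE (false ∷ true ∷ u) (scaleE c p)) (init-replicate n false) (last-replicate n false) ⟩
  addE (false ∷ true ∷ replicate n false) (scaleE false p)
    ≡⟨ cong (addE _) (scaleE-false p) ⟩
  addE (false ∷ true ∷ replicate n false) zeroE
    ≡⟨ addE-identityʳ _ ⟩
  false ∷ true ∷ replicate n false ∎
  where open ≡-Reasoning

mulE-α : (p x : Elem n) → mulE p (α p) x ≡ mulα p x
mulE-α {zero}        p        x        = refl
mulE-α {suc zero}    (c ∷ []) (x ∷ []) = cong (_∷ []) (trans (xor-identityʳ _) (∧-comm c x))
mulE-α {suc (suc n)} p        x        = begin
  mulAux p (α p) x
    ≡⟨ cong (λ a → mulAux p a x) (α≡e₁ p) ⟩
  addE (scaleE false x) (addE (scaleE true (mulα p x)) (mulAux p (replicate n false) (mulα p (mulα p x))))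
    ≡⟨ cong₂ (λ u v → addE u (addE (scaleE true (mulα p x)) v)) (scaleE-false x) (mulAux-zeroˡ n p _) ⟩
  addE zeroE (addE (scaleE true (mulα p x)) zeroE)
    ≡⟨ trans (addE-identityˡ _) (trans (addE-identityʳ _) (scaleE-true _)) ⟩
  mulα p x ∎
  where open ≡-Reasoning

bitAt : Vec Bool m → ℕ → Bool
bitAt []       i       = false
bitAt (x ∷ xs) zero    = x
bitAt (x ∷ xs) (suc i) = bitAt xs i

bitAt-ext : (a b : Vec Bool m) → (∀ i → bitAt a i ≡ bitAt b i) → a ≡ b
bitAt-ext []      []      _  = refl
bitAt-ext (x ∷ a) (y ∷ b) eq = cong₂ _∷_ (eq zero) (bitAt-ext a b (eq ∘ suc))

bitAt-addE : (a b : Elem n) → ∀ i → bitAt (addE a b) i ≡ bitAt a i xor bitAt b i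
bitAt-addE []      []      i       = refl
bitAt-addE (x ∷ a) (y ∷ b) zero    = refl
bitAt-addE (x ∷ a) (y ∷ b) (suc i) = bitAt-addE a b i

bitAt-scaleE : ∀ c (a : Elem n) i → bitAt (scaleE c a) i ≡ c ∧ bitAt a i
bitAt-scaleE c []      i       = sym (∧-zeroʳ c)
bitAt-scaleE c (x ∷ a) zero    = refl
bitAt-scaleE c (x ∷ a) (suc i) = bitAt-scaleE c a i

bitAt-replicate-false : ∀ k i → bitAt (replicate k false) i ≡ false
bitAt-replicate-false zero    i       = refl
bitAt-replicate-false (suc k) zero    = refl
bitAt-replicate-false (suc k) (suc i) = bitAt-replicate-false k i

bitAt-init : (b : Vec Bool (suc m)) → last b ≡ false → ∀ i → bitAt (init b) i ≡ bitAt b i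
bitAt-init {zero}  (x ∷ []) x≡false zero    = sym x≡false
bitAt-init {zero}  (x ∷ []) _       (suc i) = refl
bitAt-init {suc m} (x ∷ b)  _       zero    = refl
bitAt-init {suc m} (x ∷ b)  b≡false (suc i) = bitAt-init b b≡false i

last≡bitAt : (b : Vec Bool (suc m)) → last b ≡ bitAt b m
last≡bitAt {zero}  (x ∷ []) = refl
last≡bitAt {suc m} (x ∷ b)  = last≡bitAt b

IsBasisVector : ℕ → Vec Bool m → Set
IsBasisVector j b = ∀ i → bitAt b i ≡ (i ≡ᵇ j)

<⇒≡ᵇ-false : ∀ {i j} → j < i → (i ≡ᵇ j) ≡ false
<⇒≡ᵇ-false {suc i} {zero}  _         = refl
<⇒≡ᵇ-false {suc i} {suc j} (s≤s j<i) = <⇒≡ᵇ-false j<i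

mulα-basis : ∀ {j} (p b : Elem n) → IsBasisVector j b → suc j < n → IsBasisVector (suc j) (mulα p b)
mulα-basis {suc n} {j} p b b≡eⱼ (s≤s j<n) i = begin
  bitAt (addE (false ∷ init b) (scaleE (last b) p)) i
    ≡⟨ cong (λ c → bitAt (addE (false ∷ init b) (scaleE c p)) i) last≡false ⟩
  bitAt (addE (false ∷ init b) (scaleE false p)) i
    ≡⟨ cong (λ v → bitAt (addE (false ∷ init b) v) i) (scaleE-false p) ⟩
  bitAt (addE (false ∷ init b) zeroE) i
    ≡⟨ cong (λ v → bitAt v i) (addE-identityʳ (false ∷ init b)) ⟩
  bitAt (false ∷ init b) i
    ≡⟨ shifted i ⟩
  (i ≡ᵇ suc j) ∎
  where
  open ≡-Reasoning
  last≡false : last b ≡ false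
  last≡false = trans (last≡bitAt b) (trans (b≡eⱼ n) (<⇒≡ᵇ-false j<n))
  shifted : ∀ i → bitAt (false ∷ init b) i ≡ (i ≡ᵇ suc j)
  shifted zero    = refl
  shifted (suc i) = trans (bitAt-init b last≡false i) (b≡eⱼ i)

bitAt-replicate-++-[] : ∀ j i → bitAt (replicate j false ++ []) i ≡ false
bitAt-replicate-++-[] zero    i       = refl
bitAt-replicate-++-[] (suc j) zero    = refl
bitAt-replicate-++-[] (suc j) (suc i) = bitAt-replicate-++-[] j i

bitAt-replicate-++-∷ : ∀ j a (as : Vec Bool m) i →
  bitAt (replicate j false ++ a ∷ as) i ≡ (a ∧ (i ≡ᵇ j)) xor bitAt (replicate (suc j) false ++ as) i
bitAt-replicate-++-∷ zero    a as zero    = sym (trans (xor-identityʳ _) (∧-identityʳ a))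
bitAt-replicate-++-∷ zero    a as (suc i) = sym (cong (_xor bitAt as i) (∧-zeroʳ a))
bitAt-replicate-++-∷ (suc j) a as zero    = sym (trans (xor-identityʳ _) (∧-zeroʳ a))
bitAt-replicate-++-∷ (suc j) a as (suc i) = bitAt-replicate-++-∷ j a as i

bitAt-zeroE : ∀ n j i → bitAt (zeroE {n}) i ≡ bitAt (replicate j false ++ []) i
bitAt-zeroE n j i = trans (bitAt-replicate-false n i) (sym (bitAt-replicate-++-[] j i))

mulAux-basis : ∀ (p : Elem n) j (as : Vec Bool m) b → j + m ≤ n → IsBasisVector j b →
  ∀ i → bitAt (mulAux p as b) i ≡ bitAt (replicate j false ++ as) i
mulAux-basis {n} p j []       b _ _ i = bitAt-zeroE n j i
mulAux-basis {n} p j (a ∷ as) b j+m≤n b≡eⱼ i = begin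
  bitAt (addE (scaleE a b) (mulAux p as (mulα p b))) i
    ≡⟨ bitAt-addE (scaleE a b) _ i ⟩
  bitAt (scaleE a b) i xor bitAt (mulAux p as (mulα p b)) i
    ≡⟨ cong₂ _xor_ (trans (bitAt-scaleE a b i) (cong (a ∧_) (b≡eⱼ i)))
                   (tail as (subst (_≤ n) (+-suc j _) j+m≤n)) ⟩
  (a ∧ (i ≡ᵇ j)) xor bitAt (replicate (suc j) false ++ as) i
    ≡⟨ bitAt-replicate-++-∷ j a as i ⟨
  bitAt (replicate j false ++ a ∷ as) i ∎
  where
  open ≡-Reasoning
  tail : ∀ {k} (as : Vec Bool k) → suc j + k ≤ n →
    bitAt (mulAux p as (mulα p b)) i ≡ bitAt (replicate (suc j) false ++ as) i
  tail []         _  = bitAt-zeroE n (suc j) i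
  tail (a′ ∷ as′) le = mulAux-basis p (suc j) (a′ ∷ as′) (mulα p b) le
    (mulα-basis p b b≡eⱼ (≤-trans (s≤s (s≤s (m≤m+n j _))) (subst (_≤ n) (+-suc (suc j) _) le))) i

mulE-oneʳ : (p a : Elem n) → mulE p a oneE ≡ a
mulE-oneʳ {zero}  p [] = refl
mulE-oneʳ {suc n} p a  = bitAt-ext _ a (mulAux-basis p 0 a oneE ≤-refl oneE≡e₀)
  where
  oneE≡e₀ : IsBasisVector 0 (oneE {suc n})
  oneE≡e₀ zero    = refl
  oneE≡e₀ (suc i) = bitAt-replicate-false n i

-- Powers of α

α^ : Elem n → ℕ → Elem n
α^ p = powE p (α p)

α^-+ : (p : Elem n) (a b : ℕ) → mulE p (α^ p a) (α^ p b) ≡ α^ p (a + b)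
α^-+ p a zero    = trans (mulE-oneʳ p _) (cong (α^ p) (sym (+-identityʳ a)))
α^-+ p a (suc b) = begin
  mulE p (α^ p a) (mulE p (α p) (α^ p b))   ≡⟨ cong (mulE p (α^ p a)) (mulE-α p (α^ p b)) ⟩
  mulE p (α^ p a) (mulα p (α^ p b))         ≡⟨ mulAux-mulα p (α^ p a) (α^ p b) ⟩
  mulα p (mulE p (α^ p a) (α^ p b))         ≡⟨ cong (mulα p) (α^-+ p a b) ⟩
  mulα p (α^ p (a + b))                     ≡⟨ mulE-α p (α^ p (a + b)) ⟨
  α^ p (suc (a + b))                        ≡⟨ cong (α^ p) (+-suc a b) ⟨
  α^ p (a + suc b)                          ∎
  where open ≡-Reasoning

prodE-map-α^ : ∀ {A : Set} {k} (p : Elem n) (f : A → ℕ) (xs : Vec A k) →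
  prodE p (map (λ x → α^ p (f x)) xs) ≡ α^ p (sum (map f xs))
prodE-map-α^ p f []       = refl
prodE-map-α^ p f (x ∷ xs) =
  trans (cong (mulE p (α^ p (f x))) (prodE-map-α^ p f xs)) (α^-+ p (f x) (sum (map f xs)))

2^[1+n]∸1-nonZero : ∀ n → NonZero (2 ^ suc n ∸ 1)
2^[1+n]∸1-nonZero n = >-nonZero (m<n⇒0<n∸m (^-monoʳ-< 2 (s≤s (s≤s z≤n)) {0} {suc n} (s≤s z≤n)))

oneE≢zeroE : oneE {suc n} ≢ zeroE
oneE≢zeroE ()

module PrimitiveElement {p : Elem (suc n)} (p-primitive : Primitive p) where

  open ≡-Reasoning

  private
    N : ℕ
    N = 2 ^ suc n ∸ 1

    instance
      N-nonZero : NonZero N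
      N-nonZero = 2^[1+n]∸1-nonZero n

    irreducible : Irreducible p
    irreducible = proj₁ (proj₂ p-primitive)

    α^N≡1 : α^ p N ≡ oneE
    α^N≡1 = proj₁ (proj₂ (proj₂ p-primitive))

    α^m≢1 : ∀ m → 0 < m → m < N → α^ p m ≢ oneE
    α^m≢1 = proj₂ (proj₂ (proj₂ p-primitive))

  α≢zeroE : α p ≢ zeroE
  α≢zeroE α≡0 = oneE≢zeroE (begin
    oneE                            ≡⟨ α^N≡1 ⟨
    α^ p N                          ≡⟨ cong (α^ p) (suc-pred N) ⟨
    mulE p (α p) (α^ p (pred N))    ≡⟨ cong (λ a → mulE p a (α^ p (pred N))) α≡0 ⟩
    mulE p zeroE (α^ p (pred N))    ≡⟨ mulAux-zeroˡ (suc n) p _ ⟩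
    zeroE                           ∎)

  mulα-injective : ∀ x y → mulα p x ≡ mulα p y → x ≡ y
  mulα-injective x y αx≡αy with irreducible (α p) (addE x y) α[x+y]≡0
    where
    α[x+y]≡0 : mulE p (α p) (addE x y) ≡ zeroE
    α[x+y]≡0 = begin
      mulE p (α p) (addE x y)       ≡⟨ mulE-α p _ ⟩
      mulα p (addE x y)             ≡⟨ mulα-addE p x y ⟩
      addE (mulα p x) (mulα p y)    ≡⟨ cong (addE _) αx≡αy ⟨
      addE (mulα p x) (mulα p x)    ≡⟨ addE-self _ ⟩
      zeroE                         ∎
  ... | inj₁ α≡0   = ⊥-elim (α≢zeroE α≡0)
  ... | inj₂ x+y≡0 = addE≡zero⇒≡ x y x+y≡0

  α^-cancelˡ : ∀ a {x y} → α^ p (a + x) ≡ α^ p (a + y) → α^ p x ≡ α^ p y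
  α^-cancelˡ zero            eq = eq
  α^-cancelˡ (suc a) {x} {y} eq =
    α^-cancelˡ a (mulα-injective _ _ (trans (sym (mulE-α p (α^ p (a + x))))
                                            (trans eq (mulE-α p (α^ p (a + y))))))

  α^-+*N : ∀ r q → α^ p (r + q * N) ≡ α^ p r
  α^-+*N r zero    = cong (α^ p) (+-identityʳ r)
  α^-+*N r (suc q) = begin
    α^ p (r + (N + q * N))             ≡⟨ cong (λ e → α^ p (r + e)) (+-comm N (q * N)) ⟩
    α^ p (r + (q * N + N))             ≡⟨ cong (α^ p) (+-assoc r (q * N) N) ⟨
    α^ p (r + q * N + N)               ≡⟨ α^-+ p (r + q * N) N ⟨
    mulE p (α^ p (r + q * N)) (α^ p N) ≡⟨ cong (mulE p (α^ p (r + q * N))) α^N≡1 ⟩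
    mulE p (α^ p (r + q * N)) oneE     ≡⟨ mulE-oneʳ p _ ⟩
    α^ p (r + q * N)                   ≡⟨ α^-+*N r q ⟩
    α^ p r                             ∎

  α^-% : ∀ m → α^ p (m % N) ≡ α^ p m
  α^-% m = trans (sym (α^-+*N (m % N) (m / N))) (cong (α^ p) (sym (m≡m%n+[m/n]*n m N)))

  α^-injective-< : ∀ {r s} → r ≤ s → s < N → α^ p r ≡ α^ p s → r ≡ s
  α^-injective-< {r} r≤s s<N α^r≡α^s with m≤n⇒∃[o]m+o≡n r≤s
  ... | zero  , refl = sym (+-identityʳ r)
  ... | suc d , refl = ⊥-elim (α^m≢1 (suc d) (s≤s z≤n) (≤-<-trans (m≤n+m (suc d) r) s<N) (sym α^0≡α^[1+d]))
    where
    α^0≡α^[1+d] : α^ p 0 ≡ α^ p (suc d)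
    α^0≡α^[1+d] = α^-cancelˡ r (trans (cong (α^ p) (+-identityʳ r)) α^r≡α^s)

  α^-≡⇔ : ∀ a b → α^ p a ≡ α^ p b ⇔ a % N ≡ b % N
  α^-≡⇔ a b = mk⇔ to from
    where
    to : α^ p a ≡ α^ p b → a % N ≡ b % N
    to α^a≡α^b with ≤-total (a % N) (b % N)
    ... | inj₁ r≤s = α^-injective-< r≤s (m%n<n b N) (trans (α^-% a) (trans α^a≡α^b (sym (α^-% b))))
    ... | inj₂ s≤r = sym (α^-injective-< s≤r (m%n<n a N)
                                         (trans (α^-% b) (trans (sym α^a≡α^b) (sym (α^-% a)))))
    from : a % N ≡ b % N → α^ p a ≡ α^ p b
    from eq = trans (sym (α^-% a)) (trans (cong (α^ p) eq) (α^-% b))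

-- Congruences modulo N in ℤ

∣∧<⇒≡0 : ∀ {d x} .{{_ : NonZero d}} → d ∣ℕ x → x < d → x ≡ 0
∣∧<⇒≡0 {d} {x} d∣x x<d = trans (sym (m<n⇒m%n≡m x<d)) (n∣m⇒m%n≡0 x d d∣x)

∣-<⇒≡ : ∀ {N r s} .{{_ : NonZero N}} → r < N → s < N → + N ∣ + r - + s → r ≡ s
∣-<⇒≡ {N} {r} {s} r<N s<N N∣r-s = ℤ.+-injective (ℤ.i-j≡0⇒i≡j (+ r) (+ s) (ℤ.∣i∣≡0⇒i≡0 ∣r-s∣≡0))
  where
  ∣r-s∣<N : ℤ.∣ + r - + s ∣ < N
  ∣r-s∣<N = subst (_< N) (cong ℤ.∣_∣ (sym (ℤ.m-n≡m⊖n r s)))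
                   (≤-<-trans (ℤ.∣m⊝n∣≤m⊔n r s) (⊔-pres-<m r<N s<N))
  ∣r-s∣≡0 : ℤ.∣ + r - + s ∣ ≡ 0
  ∣r-s∣≡0 = ∣∧<⇒≡0 N∣r-s ∣r-s∣<N

∣-⇔-%ℕ : ∀ N .{{_ : NonZero N}} (c : ℤ) (s : ℕ) → (+ N ∣ c - + s) ⇔ (c %ℕ N ≡ s % N)
∣-⇔-%ℕ N c s = mk⇔ to from
  where
  r r′ t : ℕ
  r = c %ℕ N
  r′ = s % N
  t = s / N
  q : ℤ
  q = c /ℕ N
  +s≡ : + s ≡ + r′ ℤ.+ + t ℤ.* + N
  +s≡ = trans (cong +_ (m≡m%n+[m/n]*n s N))
              (trans (ℤ.pos-+ r′ (t * N)) (cong (ℤ._+_ (+ r′)) (ℤ.pos-* t N)))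
  rearrange : ∀ r q r′ t n → (r ℤ.+ q ℤ.* n) - (r′ ℤ.+ t ℤ.* n) ≡ (r - r′) ℤ.+ (q - t) ℤ.* n
  rearrange = ℤ-Solver.solve-∀
  c-s≡ : c - + s ≡ (+ r - + r′) ℤ.+ (q - + t) ℤ.* + N
  c-s≡ = trans (cong₂ _-_ (a≡a%ℕn+[a/ℕn]*n c N) +s≡) (rearrange (+ r) q (+ r′) (+ t) (+ N))
  N∣[q-t]N : + N Signed.∣ (q - + t) ℤ.* + N
  N∣[q-t]N = ∣n⇒∣m*n (q - + t) ∣-refl
  to : + N ∣ c - + s → r ≡ r′
  to N∣c-s = ∣-<⇒≡ (n%ℕd<d c N) (m%n<n s N)
    (∣⇒∣ᵤ (∣m+n∣n⇒∣m {m = + r - + r′} (subst (+ N Signed.∣_) c-s≡ (∣ᵤ⇒∣ N∣c-s)) N∣[q-t]N))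
  from : r ≡ r′ → + N ∣ c - + s
  from r≡r′ = ∣⇒∣ᵤ (subst (+ N Signed.∣_) (sym c-s≡[q-t]N) N∣[q-t]N)
    where
    r-r′≡0 : + r - + r′ ≡ + 0
    r-r′≡0 = trans (cong (λ x → + x - + r′) r≡r′) (ℤ.+-inverseʳ (+ r′))
    c-s≡[q-t]N : c - + s ≡ (q - + t) ℤ.* + N
    c-s≡[q-t]N = trans c-s≡ (trans (cong (ℤ._+ (q - + t) ℤ.* + N) r-r′≡0) (ℤ.+-identityˡ _))

-- Subsets of [m] as binary numbers

sum-tabulate-* : ∀ c (f : Fin m → ℕ) → sum (tabulate (λ i → c * f i)) ≡ c * sum (tabulate f)
sum-tabulate-* {zero}  c f = sym (*-zeroʳ c)
sum-tabulate-* {suc m} c f = trans (cong (_+_ (c * f fzero)) (sum-tabulate-* c (λ i → f (fsuc i))))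
                                   (sym (*-distribˡ-+ c (f fzero) _))

subsetSum-∷ : ∀ b (S : Subset m) → subsetSum (b ∷ S) ≡ (if b then 1 else 0) + 2 * subsetSum S
subsetSum-∷ b S = cong (_+_ (if b then 1 else 0)) (begin
  sum (tabulate (λ i → if lookup S i then 2 * 2 ^ toℕ i else 0))
    ≡⟨ cong sum (tabulate-cong (λ i → sym (if-float (2 *_) (lookup S i)))) ⟩
  sum (tabulate (λ i → 2 * (if lookup S i then 2 ^ toℕ i else 0)))
    ≡⟨ sum-tabulate-* 2 (λ i → if lookup S i then 2 ^ toℕ i else 0) ⟩
  2 * subsetSum S ∎)
  where open ≡-Reasoning

subsetSum-∅ : ∀ m → subsetSum (∅ {m}) ≡ 0
subsetSum-∅ zero    = refl
subsetSum-∅ (suc m) = trans (subsetSum-∷ false (∅ {m})) (cong (2 *_) (subsetSum-∅ m))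

subsetSum<2^m : (S : Subset m) → subsetSum S < 2 ^ m
subsetSum<2^m []              = s≤s z≤n
subsetSum<2^m {suc m} (b ∷ S) = begin-strict
  subsetSum (b ∷ S)                      ≡⟨ subsetSum-∷ b S ⟩
  (if b then 1 else 0) + 2 * subsetSum S <⟨ s≤s (+-monoˡ-≤ (2 * subsetSum S) (bit≤1 b)) ⟩
  2 + 2 * subsetSum S                    ≡⟨ *-suc 2 (subsetSum S) ⟨
  2 * suc (subsetSum S)                  ≤⟨ *-monoʳ-≤ 2 (subsetSum<2^m S) ⟩
  2 * 2 ^ m                              ∎
  where
  open ≤-Reasoning
  bit≤1 : ∀ b → (if b then 1 else 0) ≤ 1
  bit≤1 true  = s≤s z≤n
  bit≤1 false = z≤n

0<subsetSum⇒0<∣S∣ : (S : Subset m) → 0 < subsetSum S → 0 < ∣ S ∣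
0<subsetSum⇒0<∣S∣ (true  ∷ S) _   = s≤s z≤n
0<subsetSum⇒0<∣S∣ (false ∷ S) 0<s =
  0<subsetSum⇒0<∣S∣ S (*-cancelˡ-< 2 0 (subsetSum S) (subst (0 <_) (subsetSum-∷ false S) 0<s))

Carried : ℕ → Set
Carried m = Subset m × Bool

valueᶜ : Carried m → ℕ
valueᶜ {m} (S , c) = subsetSum S + (if c then 2 ^ m else 0)

sizeᶜ : Carried m → ℕ
sizeᶜ (S , c) = ∣ S ∣ + (if c then 1 else 0)

valueᶜ-∷ : ∀ b (S : Subset m) c → valueᶜ (b ∷ S , c) ≡ (if b then 1 else 0) + 2 * valueᶜ (S , c)
valueᶜ-∷ {m} b S c = begin
  subsetSum (b ∷ S) + (if c then 2 * 2 ^ m else 0)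
    ≡⟨ cong₂ _+_ (subsetSum-∷ b S) (sym (if-float (2 *_) c)) ⟩
  (if b then 1 else 0) + 2 * subsetSum S + 2 * (if c then 2 ^ m else 0)
    ≡⟨ +-assoc (if b then 1 else 0) _ _ ⟩
  (if b then 1 else 0) + (2 * subsetSum S + 2 * (if c then 2 ^ m else 0))
    ≡⟨ cong (_+_ (if b then 1 else 0)) (*-distribˡ-+ 2 (subsetSum S) _) ⟨
  (if b then 1 else 0) + 2 * valueᶜ (S , c) ∎
  where open ≡-Reasoning

increment : Subset m → Carried m
increment []          = [] , true
increment (false ∷ S) = true ∷ S , false
increment (true  ∷ S) = map₁ (false ∷_) (increment S)

addPow2 : Subset m → Fin m → Carried m
addPow2 S       fzero    = increment S
addPow2 (b ∷ S) (fsuc t) = map₁ (b ∷_) (addPow2 S t)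

increment-value : (S : Subset m) → valueᶜ (increment S) ≡ suc (subsetSum S)
increment-value []          = refl
increment-value (false ∷ S) = begin
  subsetSum (true ∷ S) + 0     ≡⟨ +-identityʳ _ ⟩
  subsetSum (true ∷ S)         ≡⟨ subsetSum-∷ true S ⟩
  suc (2 * subsetSum S)        ≡⟨ cong suc (subsetSum-∷ false S) ⟨
  suc (subsetSum (false ∷ S))  ∎
  where open ≡-Reasoning
increment-value (true ∷ S) = begin
  valueᶜ (false ∷ proj₁ (increment S) , proj₂ (increment S)) ≡⟨ valueᶜ-∷ false (proj₁ (increment S)) _ ⟩
  2 * valueᶜ (increment S)                                  ≡⟨ cong (2 *_) (increment-value S) ⟩
  2 * suc (subsetSum S)                                     ≡⟨ *-suc 2 (subsetSum S) ⟩
  suc (suc (2 * subsetSum S))                               ≡⟨ cong suc (subsetSum-∷ true S) ⟨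
  suc (subsetSum (true ∷ S))                                ∎
  where open ≡-Reasoning

addPow2-value : (S : Subset m) (t : Fin m) → valueᶜ (addPow2 S t) ≡ 2 ^ toℕ t + subsetSum S
addPow2-value S       fzero    = increment-value S
addPow2-value (b ∷ S) (fsuc t) = begin
  valueᶜ (b ∷ proj₁ (addPow2 S t) , proj₂ (addPow2 S t))
    ≡⟨ valueᶜ-∷ b (proj₁ (addPow2 S t)) _ ⟩
  (if b then 1 else 0) + 2 * valueᶜ (addPow2 S t)
    ≡⟨ cong (λ v → (if b then 1 else 0) + 2 * v) (addPow2-value S t) ⟩
  (if b then 1 else 0) + 2 * (2 ^ toℕ t + subsetSum S)
    ≡⟨ rearrange (if b then 1 else 0) (2 ^ toℕ t) _ ⟩
  2 * 2 ^ toℕ t + ((if b then 1 else 0) + 2 * subsetSum S)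
    ≡⟨ cong (_+_ (2 * 2 ^ toℕ t)) (subsetSum-∷ b S) ⟨
  2 * 2 ^ toℕ t + subsetSum (b ∷ S) ∎
  where
  open ≡-Reasoning
  rearrange : ∀ x y z → x + 2 * (y + z) ≡ 2 * y + (x + 2 * z)
  rearrange = solve-∀

increment-size : (S : Subset m) → sizeᶜ (increment S) ≤ suc ∣ S ∣
increment-size []          = ≤-refl
increment-size (false ∷ S) = ≤-reflexive (+-identityʳ _)
increment-size (true  ∷ S) = ≤-trans (increment-size S) (n≤1+n _)

addPow2-size : (S : Subset m) (t : Fin m) → sizeᶜ (addPow2 S t) ≤ suc ∣ S ∣
addPow2-size S           fzero    = increment-size S
addPow2-size (true  ∷ S) (fsuc t) = s≤s (addPow2-size S t)
addPow2-size (false ∷ S) (fsuc t) = addPow2-size S t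

tupleSum : Vec (Fin m) k → ℕ
tupleSum ts = sum (map (λ t → 2 ^ toℕ t) ts)

tupleSum-map-suc : (ts : Vec (Fin m) k) → tupleSum (map fsuc ts) ≡ 2 * tupleSum ts
tupleSum-map-suc []       = refl
tupleSum-map-suc (t ∷ ts) = trans (cong (_+_ (2 * 2 ^ toℕ t)) (tupleSum-map-suc ts))
                                  (sym (*-distribˡ-+ 2 (2 ^ toℕ t) (tupleSum ts)))

elements : (S : Subset m) → Vec (Fin m) ∣ S ∣
elements []          = []
elements (true  ∷ S) = fzero ∷ map fsuc (elements S)
elements (false ∷ S) = map fsuc (elements S)

tupleSum-elements : (S : Subset m) → tupleSum (elements S) ≡ subsetSum S
tupleSum-map-suc-elements : (S : Subset m) → tupleSum (map fsuc (elements S)) ≡ 2 * subsetSum S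

tupleSum-elements []          = refl
tupleSum-elements (true  ∷ S) = trans (cong suc (tupleSum-map-suc-elements S)) (sym (subsetSum-∷ true S))
tupleSum-elements (false ∷ S) = trans (tupleSum-map-suc-elements S) (sym (subsetSum-∷ false S))

tupleSum-map-suc-elements S = trans (tupleSum-map-suc (elements S)) (cong (2 *_) (tupleSum-elements S))

increment-exact : (S : Subset m) → suc (subsetSum S) < 2 ^ m → subsetSum (proj₁ (increment S)) ≡ suc (subsetSum S)
increment-exact {m} S bound with increment S | increment-value S
... | S′ , false | value≡ = trans (sym (+-identityʳ _)) value≡
... | S′ , true  | value≡ = ⊥-elim (<⇒≱ bound (subst (2 ^ m ≤_) value≡ (m≤n+m (2 ^ m) (subsetSum S′))))

x+x≡2*x : ∀ x → x + x ≡ 2 * x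
x+x≡2*x x = cong (_+_ x) (sym (+-identityʳ x))

module SumsOfPowersOfTwo (n : ℕ) where

  private
    M N : ℕ
    M = 2 ^ suc n
    N = M ∸ 1

    instance
      N-nonZero : NonZero N
      N-nonZero = 2^[1+n]∸1-nonZero n

  %-cong-+ : ∀ {a b c d} → a % N ≡ b % N → c % N ≡ d % N → (a + c) % N ≡ (b + d) % N
  %-cong-+ {a} {b} {c} {d} a≡b c≡d = begin
    (a + c) % N               ≡⟨ %-distribˡ-+ a c N ⟩
    (a % N + c % N) % N       ≡⟨ cong₂ (λ x y → (x + y) % N) a≡b c≡d ⟩
    (b % N + d % N) % N       ≡⟨ %-distribˡ-+ b d N ⟨
    (b + d) % N               ∎
    where open ≡-Reasoning

  [a+M]%N≡[1+a]%N : ∀ a → (a + M) % N ≡ suc a % N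
  [a+M]%N≡[1+a]%N a = begin
    (a + M) % N           ≡⟨ cong (λ x → (a + x) % N) (sym (m+[n∸m]≡n (m^n>0 2 (suc n)))) ⟩
    (a + suc N) % N       ≡⟨ cong (_% N) (+-suc a N) ⟩
    (suc a + N) % N       ≡⟨ [m+n]%n≡m%n (suc a) N ⟩
    suc a % N             ∎
    where open ≡-Reasoning

  halve : Fin (suc n) → Fin (suc n)
  halve fzero    = fromℕ n
  halve (fsuc t) = inject₁ t

  halve-double : ∀ t → (2 ^ toℕ (halve t) + 2 ^ toℕ (halve t)) % N ≡ 2 ^ toℕ t % N
  halve-double fzero    = begin
    (2 ^ toℕ (fromℕ n) + 2 ^ toℕ (fromℕ n)) % N  ≡⟨ cong (λ e → (2 ^ e + 2 ^ e) % N) (toℕ-fromℕ n) ⟩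
    (2 ^ n + 2 ^ n) % N                          ≡⟨ cong (_% N) (x+x≡2*x (2 ^ n)) ⟩
    2 ^ suc n % N                                ≡⟨ [a+M]%N≡[1+a]%N 0 ⟩
    1 % N                                        ∎
    where open ≡-Reasoning
  halve-double (fsuc t) = cong (_% N) (trans (cong (λ e → 2 ^ e + 2 ^ e) (toℕ-inject₁ t)) (x+x≡2*x (2 ^ toℕ t)))

  splitHead : Vec (Fin (suc n)) (suc k) → Vec (Fin (suc n)) (suc (suc k))
  splitHead (t ∷ ts) = halve t ∷ halve t ∷ ts

  splitHead-value : (ts : Vec (Fin (suc n)) (suc k)) → tupleSum (splitHead ts) % N ≡ tupleSum ts % N
  splitHead-value (t ∷ ts) = trans (cong (_% N) (sym (+-assoc (2 ^ toℕ (halve t)) _ (tupleSum ts))))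
                                   (%-cong-+ (halve-double t) refl)

  pad : ∀ {ℓ} → k ≤′ ℓ → Vec (Fin (suc n)) (suc k) → Vec (Fin (suc n)) (suc ℓ)
  pad ≤′-refl       ts = ts
  pad (≤′-step k≤ℓ) ts = splitHead (pad k≤ℓ ts)

  pad-value : ∀ {ℓ} (k≤ℓ : k ≤′ ℓ) (ts : Vec (Fin (suc n)) (suc k)) →
    tupleSum (pad k≤ℓ ts) % N ≡ tupleSum ts % N
  pad-value ≤′-refl       ts = refl
  pad-value (≤′-step k≤ℓ) ts = trans (splitHead-value (pad k≤ℓ ts)) (pad-value k≤ℓ ts)

  lengthen : ∀ {ℓ} → 0 < k → k ≤ ℓ → Vec (Fin (suc n)) k → Vec (Fin (suc n)) ℓ
  lengthen {suc k} {suc ℓ} _ (s≤s k≤ℓ) = pad (≤⇒≤′ k≤ℓ)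

  lengthen-value : ∀ {ℓ} (0<k : 0 < k) (k≤ℓ : k ≤ ℓ) (ts : Vec (Fin (suc n)) k) →
    tupleSum (lengthen 0<k k≤ℓ ts) % N ≡ tupleSum ts % N
  lengthen-value {suc k} {suc ℓ} _ (s≤s k≤ℓ) = pad-value (≤⇒≤′ k≤ℓ)

  -- since 2^n ≡ 1 (mod N), a carry out of the top position is fed back in at position 0
  endAround : Carried (suc n) → Subset (suc n)
  endAround (S , false) = S
  endAround (S , true)  = proj₁ (increment S)

  private
    no-second-carry : (S : Subset (suc n)) → suc (valueᶜ (S , true)) < M + M → suc (subsetSum S) < M
    no-second-carry S = +-cancelʳ-< M (suc (subsetSum S)) M

  endAround-value : (r : Carried (suc n)) → suc (valueᶜ r) < M + M →
    subsetSum (endAround r) % N ≡ valueᶜ r % N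
  endAround-value (S , false) _     = cong (_% N) (sym (+-identityʳ _))
  endAround-value (S , true)  bound =
    trans (cong (_% N) (increment-exact S (no-second-carry S bound))) (sym ([a+M]%N≡[1+a]%N (subsetSum S)))

  endAround-nonempty : (r : Carried (suc n)) → 0 < valueᶜ r → suc (valueᶜ r) < M + M → 0 < ∣ endAround r ∣
  endAround-nonempty (S , false) 0<v _     = 0<subsetSum⇒0<∣S∣ S (subst (0 <_) (+-identityʳ _) 0<v)
  endAround-nonempty (S , true)  _   bound = 0<subsetSum⇒0<∣S∣ (proj₁ (increment S))
    (subst (0 <_) (sym (increment-exact S (no-second-carry S bound))) (s≤s z≤n))

  endAround-size : (r : Carried (suc n)) → ∣ endAround r ∣ ≤ sizeᶜ r
  endAround-size (S , false) = ≤-reflexive (sym (+-identityʳ _))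
  endAround-size (S , true)  = ≤-trans (m≤m+n _ _) (≤-trans (increment-size S) (≤-reflexive (+-comm 1 ∣ S ∣)))

  addPow2ModN : Subset (suc n) → Fin (suc n) → Subset (suc n)
  addPow2ModN S t = endAround (addPow2 S t)

  private
    addPow2-bound : (S : Subset (suc n)) (t : Fin (suc n)) → suc (valueᶜ (addPow2 S t)) < M + M
    addPow2-bound S t = subst (_< M + M) (trans (+-suc _ _) (cong suc (sym (addPow2-value S t))))
      (+-mono-<-≤ (^-monoʳ-< 2 (s≤s (s≤s z≤n)) (toℕ<n t)) (subsetSum<2^m S))

  addPow2ModN-value : (S : Subset (suc n)) (t : Fin (suc n)) →
    subsetSum (addPow2ModN S t) % N ≡ (2 ^ toℕ t + subsetSum S) % N
  addPow2ModN-value S t = trans (endAround-value (addPow2 S t) (addPow2-bound S t)) (cong (_% N) (addPow2-value S t))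

  addPow2ModN-nonempty : (S : Subset (suc n)) (t : Fin (suc n)) → 0 < ∣ addPow2ModN S t ∣
  addPow2ModN-nonempty S t = endAround-nonempty (addPow2 S t) 0<value (addPow2-bound S t)
    where
    0<value : 0 < valueᶜ (addPow2 S t)
    0<value = subst (0 <_) (sym (addPow2-value S t)) (≤-trans (m^n>0 2 (toℕ t)) (m≤m+n _ _))

  addPow2ModN-size : (S : Subset (suc n)) (t : Fin (suc n)) → ∣ addPow2ModN S t ∣ ≤ suc ∣ S ∣
  addPow2ModN-size S t = ≤-trans (endAround-size (addPow2 S t)) (addPow2-size S t)

  merge : Vec (Fin (suc n)) k → Subset (suc n)
  merge []       = ∅
  merge (t ∷ ts) = addPow2ModN (merge ts) t

  merge-size : (ts : Vec (Fin (suc n)) k) → ∣ merge ts ∣ ≤ k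
  merge-size []       = ≤-reflexive (∣⊥∣≡0 (suc n))
  merge-size (t ∷ ts) = ≤-trans (addPow2ModN-size (merge ts) t) (s≤s (merge-size ts))

  merge-value : (ts : Vec (Fin (suc n)) k) → subsetSum (merge ts) % N ≡ tupleSum ts % N
  merge-value []       = cong (_% N) (subsetSum-∅ (suc n))
  merge-value (t ∷ ts) = trans (addPow2ModN-value (merge ts) t) (%-cong-+ refl (merge-value ts))

  tuples⇔subsets : ∀ k → 1 ≤ k → ∀ r →
    (∃ λ (ts : Vec (Fin (suc n)) k) → tupleSum ts % N ≡ r) ⇔
    (∃ λ (S : Subset (suc n)) → 0 < ∣ S ∣ × ∣ S ∣ ≤ k × subsetSum S % N ≡ r)
  tuples⇔subsets (suc k) _ r = mk⇔ to from
    where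
    to : (∃ λ (ts : Vec (Fin (suc n)) (suc k)) → tupleSum ts % N ≡ r) → _
    to (t ∷ ts , ≡r) =
      merge (t ∷ ts) , addPow2ModN-nonempty (merge ts) t , merge-size (t ∷ ts) , trans (merge-value (t ∷ ts)) ≡r
    from : (∃ λ (S : Subset (suc n)) → 0 < ∣ S ∣ × ∣ S ∣ ≤ suc k × subsetSum S % N ≡ r) → _
    from (S , 0<∣S∣ , ∣S∣≤k , ≡r) = lengthen 0<∣S∣ ∣S∣≤k (elements S) ,
      trans (lengthen-value 0<∣S∣ ∣S∣≤k (elements S)) (trans (cong (_% N) (tupleSum-elements S)) ≡r)

modN-nonZero : ∀ m .{{_ : NonZero m}} c → modN m c ≡ c %ℕ m
modN-nonZero (suc m) c = refl

≡⇔≡ : ∀ {A : Set} {a a′ b b′ : A} → a ≡ a′ → b ≡ b′ → (a ≡ b) ⇔ (a′ ≡ b′)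
≡⇔≡ refl refl = ⇔-id _

lemma10p1 : ∀ {n} (p : Vec Bool n) → Primitive p →
    (k : ℕ) → 1 ≤ k → (c : ℤ) →
    (∃ λ (t : Vec (Fin n) k) →
        prodE p (map (λ tᵢ → powE p (α p) (2 ^ toℕ tᵢ)) t) ≡ powℤE p (α p) c)
    ⇔
    (∃ λ (S : Subset n) →
        (0 < ∣ S ∣) × (∣ S ∣ ≤ k) × ((+ (2 ^ n ∸ 1)) ∣ (c - + subsetSum S)))
lemma10p1 {zero}  p (() , _)    k 1≤k c
lemma10p1 {suc n} p p-primitive k 1≤k c = begin
  (∃ λ (t : Vec (Fin (suc n)) k) → prodE p (map (λ tᵢ → powE p (α p) (2 ^ toℕ tᵢ)) t) ≡ powℤE p (α p) c)
    ≈⟨ congˡ (λ {t} → tuple-condition t) ⟩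
  (∃ λ (t : Vec (Fin (suc n)) k) → tupleSum t % N ≡ c %ℕ N)
    ≈⟨ tuples⇔subsets k 1≤k (c %ℕ N) ⟩
  (∃ λ (S : Subset (suc n)) → 0 < ∣ S ∣ × ∣ S ∣ ≤ k × subsetSum S % N ≡ c %ℕ N)
    ≈⟨ congˡ (λ {S} → ⇔-id _ ×-⇔ (⇔-id _ ×-⇔ subset-condition S)) ⟩
  (∃ λ (S : Subset (suc n)) → 0 < ∣ S ∣ × ∣ S ∣ ≤ k × + N ∣ c - + subsetSum S) ∎
  where
  open PrimitiveElement p-primitive
  open SumsOfPowersOfTwo n
  open import Relation.Binary.Reasoning.Setoid (⇔-setoid 0ℓ)
  N : ℕ
  N = 2 ^ suc n ∸ 1
  instance
    N-nonZero : NonZero N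
    N-nonZero = 2^[1+n]∸1-nonZero n
  tuple-condition : ∀ t → (prodE p (map (λ tᵢ → powE p (α p) (2 ^ toℕ tᵢ)) t) ≡ powℤE p (α p) c)
                          ⇔ (tupleSum t % N ≡ c %ℕ N)
  tuple-condition t = ≡⇔≡ refl (m<n⇒m%n≡m (n%ℕd<d c N)) ⇔-∘ (α^-≡⇔ (tupleSum t) (c %ℕ N) ⇔-∘
                      ≡⇔≡ (prodE-map-α^ p (λ tᵢ → 2 ^ toℕ tᵢ) t) (cong (α^ p) (modN-nonZero N c)))
  subset-condition : ∀ S → (subsetSum S % N ≡ c %ℕ N) ⇔ (+ N ∣ c - + subsetSum S)
  subset-condition S = ⇔-sym (mk⇔ sym sym ⇔-∘ ∣-⇔-%ℕ N c (subsetSum S))
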